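{- Let $G$ be a finite simple graph with vertices $v_1,\dots,v_n$, edges $e_1,\dots,e_m$ and maximum degree $\Delta$, and let $p\geq m^2(2\Delta+2)$ be a prime. Consider the polynomial over $\mathbb{Z}_p$ in the variables $v_1,\dots,v_n,e_1,\dots,e_m$ $$\mathbf{P}(v_1,\dots,v_n,e_1,\dots,e_m)=\prod_{i=1}^{n}\Bigg(\prod_{v_j\in N_i(v_i)}(v_i-v_j)\prod_{e_j\in N_e(v_i)}(v_i-e_j)\prod_{l=\Delta+2}^{p}(v_i-l)\Bigg),$$ and let $\mathbf{P}'$ be its reduction. Then there exist integers $l_1,\dots,l_n\geq 0$ such that the coefficient $\mathcal{C}^{\mathbf{P}'}(e_1,\dots,e_m)$ of the monomial $\prod_{j=1}^n v_j^{l_j}$ in $\mathbf{P}'$ (viewing $\mathbf{P}'$ as a polynomial in $v_1,\dots,v_n$ with coefficients in $\mathbb{Z}_p[e_1,\dots,e_m]$) is not the zero polynomial.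
   Context: $N(v_i)$ is the set of neighbours of $v_i$; $N_1(v_1)=N(v_1)$ and, for $2\le i\le n$, $N_i(v_i)=N(v_i)\setminus\{v_1,\dots,v_{i-1}\}$ (an empty product equals $1$). $N_e(v_i)$ is the set of edges incident to $v_i$. The integers $l$ in $\prod_{l=\Delta+2}^p(v_i-l)$ are taken modulo $p$. For a polynomial $F$ over $\mathbb{Z}_p$, its reduction $F'$ is the polynomial obtained by repeatedly replacing $x^p$ by $x$ for each variable $x$ (Fermat's theorem), so that every variable has exponent at most $p-1$ in $F'$; $F'$ is "$\not\equiv 0 \bmod p$" if it has a monomial with nonzero coefficient in $\mathbb{Z}_p$. -}

module Defs where

open import Data.Nat as ℕ using (ℕ; zero; suc; _∸_; _%_; _⊔_)
import Data.Nat.Properties as ℕP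
open import Data.Integer as ℤ using (ℤ; +_; -_)
open import Data.Fin as Fin using (Fin)
import Data.Fin.Properties as FinP
open import Data.Vec as Vec using (Vec; []; _∷_; lookup; replicate; updateAt)
import Data.Vec.Properties as VecP
open import Data.Vec.Relation.Unary.Any using (Any; any?)
open import Data.List as List using (List; []; _∷_; _++_; filter; allFin; concatMap; foldr; map; length)
open import Data.Product using (_×_; _,_; proj₁; proj₂)
open import Data.Sum using (_⊎_)
open import Relation.Binary.PropositionalEquality using (_≡_; _≢_)
open import Relation.Nullary using (Dec; ¬_)
open import Relation.Nullary.Decidable using (_⊎-dec_; _×-dec_)

Edges : ℕ → ℕ → Set
Edges n m = Vec (Fin n × Fin n) m

Simple : ∀ {n m} → Edges n m → Set
Simple {n} {m} E =
  (∀ (k : Fin m) → proj₁ (lookup E k) ≢ proj₂ (lookup E k)) ×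
  (∀ (k k' : Fin m) → k ≢ k' →
     ¬ ((lookup E k ≡ lookup E k') ⊎
        (proj₁ (lookup E k) ≡ proj₂ (lookup E k') × proj₂ (lookup E k) ≡ proj₁ (lookup E k'))))

Incident : ∀ {n m} → Edges n m → Fin n → Fin m → Set
Incident E i k = (proj₁ (lookup E k) ≡ i) ⊎ (proj₂ (lookup E k) ≡ i)

incident? : ∀ {n m} (E : Edges n m) (i : Fin n) (k : Fin m) → Dec (Incident E i k)
incident? E i k = (proj₁ (lookup E k) Fin.≟ i) ⊎-dec (proj₂ (lookup E k) Fin.≟ i)

Adj : ∀ {n m} → Edges n m → Fin n → Fin n → Set
Adj E i j = Any (λ e → (proj₁ e ≡ i × proj₂ e ≡ j) ⊎ (proj₁ e ≡ j × proj₂ e ≡ i)) E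

adj? : ∀ {n m} (E : Edges n m) (i j : Fin n) → Dec (Adj E i j)
adj? E i j = any? (λ e → ((proj₁ e Fin.≟ i) ×-dec (proj₂ e Fin.≟ j)) ⊎-dec
                          ((proj₁ e Fin.≟ j) ×-dec (proj₂ e Fin.≟ i))) E

incEdges : ∀ {n m} → Edges n m → Fin n → List (Fin m)
incEdges {m = m} E i = filter (incident? E i) (allFin m)

nbrs : ∀ {n m} → Edges n m → Fin n → List (Fin n)
nbrs {n} E i = filter (adj? E i) (allFin n)

-- N_i(v_i) = N(v_i) \ {v_1,..,v_{i-1}}  (neighbours of larger index;
-- v_i itself is not a neighbour as there are no loops)
laterNbrs : ∀ {n m} → Edges n m → Fin n → List (Fin n)
laterNbrs E i = filter (λ j → i Fin.<? j) (nbrs E i)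

degree : ∀ {n m} → Edges n m → Fin n → ℕ
degree E i = length (incEdges E i)

maxDegree : ∀ {n m} → Edges n m → ℕ
maxDegree {n} E = foldr _⊔_ 0 (map (degree E) (allFin n))

-- Polynomials with integer coefficients in variables v_1..v_n, e_1..e_m,
-- as formal sums of terms  c · v^a · e^b ; coefficients in Z_p are
-- obtained by reducing the integer coefficients modulo p.

Term : ℕ → ℕ → Set
Term n m = ℤ × Vec ℕ n × Vec ℕ m

Poly : ℕ → ℕ → Set
Poly n m = List (Term n m)

unitExp : ∀ {k} → Fin k → Vec ℕ k
unitExp i = updateAt (replicate _ 0) i (λ _ → 1)

var-v : ∀ {n m} → Fin n → Poly n m
var-v i = (ℤ.1ℤ , unitExp i , replicate _ 0) ∷ []

var-e : ∀ {n m} → Fin m → Poly n m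
var-e j = (ℤ.1ℤ , replicate _ 0 , unitExp j) ∷ []

const : ∀ {n m} → ℤ → Poly n m
const c = (c , replicate _ 0 , replicate _ 0) ∷ []

neg : ∀ {n m} → Poly n m → Poly n m
neg = map (λ { (c , a , b) → (- c , a , b) })

_⊕_ : ∀ {n m} → Poly n m → Poly n m → Poly n m
_⊕_ = _++_

_⊖_ : ∀ {n m} → Poly n m → Poly n m → Poly n m
P ⊖ Q = P ⊕ neg Q

_⊗_ : ∀ {n m} → Poly n m → Poly n m → Poly n m
P ⊗ Q = concatMap (λ { (c , a , b) →
          map (λ { (d , a' , b') → (c ℤ.* d , Vec.zipWith ℕ._+_ a a' , Vec.zipWith ℕ._+_ b b') }) Q }) P

prodP : ∀ {n m} → List (Poly n m) → Poly n m
prodP = foldr _⊗_ (const ℤ.1ℤ)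

fromTo : ℕ → ℕ → List ℕ
fromTo a b = List.map (a ℕ.+_) (List.upTo (suc b ∸ a))

-- The polynomial P of the theorem (integers l taken modulo p).

factorAt : ∀ {n m} → (p : ℕ) → Edges n m → Fin n → Poly n m
factorAt {n} {m} p E i =
  prodP (map (λ j → var-v i ⊖ var-v j) (laterNbrs E i)) ⊗
  (prodP (map (λ j → var-v i ⊖ var-e j) (incEdges E i)) ⊗
   prodP (map (λ l → var-v i ⊖ const (+ (l ℕ.% suc (p ∸ 1)))) (fromTo (maxDegree E ℕ.+ 2) p)))

bigP : ∀ {n m} → (p : ℕ) → Edges n m → Poly n m
bigP {n} p E = prodP (map (factorAt p E) (allFin n))

-- Reduction via x^p = x: exponent k ↦ 0 if k = 0, else 1 + (k-1) mod (p-1).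
-- (Only used for primes p ≥ 2; for p < 2 it is the identity.)

redExp : ℕ → ℕ → ℕ
redExp (suc (suc q)) zero = zero
redExp (suc (suc q)) (suc k) = suc (k % suc q)
redExp _ k = k

-- integer representative of the coefficient of v^l e^k in the reduction P'
-- of a polynomial P (coefficients of terms whose reduced exponents are (l,k))
coeffRed : ∀ {n m} → ℕ → Poly n m → Vec ℕ n → Vec ℕ m → ℤ
coeffRed p P l k =
  List.foldr ℤ._+_ ℤ.0ℤ
    (map proj₁ (filter (λ t → VecP.≡-dec ℕP._≟_ (Vec.map (redExp p) (proj₁ (proj₂ t))) l
                          ×-dec VecP.≡-dec ℕP._≟_ (Vec.map (redExp p) (proj₂ (proj₂ t))) k) P))

-- Evaluate P at v_i = c_i, e_j = 0, where c is a greedy colouring of G with the colours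
-- 1, …, Δ + 1; the hypothesis on p is only used to make these colours smaller than p.
-- Every linear factor of P then becomes a difference of two distinct residues in [0, p),
-- so P(c, 0) is not divisible by p.  By Fermat's little theorem x^k ≡ x^(redExp k) mod p,
-- hence P(c, 0) ≡ P'(c, 0), which is the sum over the monomials of P' of their
-- coefficients times integers.

module Submission where

open import Algebra.Bundles using (Semiring; CommutativeRing)
open import Algebra.Structures using (IsCommutativeRing)
open import Data.Integer as ℤ using (ℤ; +_; -_; _-_; 0ℤ; 1ℤ; ∣_∣)
import Data.Integer.Properties as ℤP
import Data.Nat.Properties as ℕP
open import Data.Integer.Tactic.RingSolver using (solve-∀)
open import Data.Nat as ℕ using (ℕ; zero; suc; _∸_)
open import Data.Nat.Primality using (Prime)
open import Data.Fin using (Fin)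
open import Data.Product using (_,_)
open import Level using (0ℓ)
open import Relation.Binary using (Rel; DecidableEquality)
open import Function using (_∘_)
open import Relation.Binary.PropositionalEquality using (_≡_; _≢_; refl; sym; trans; cong; cong₂; subst; subst₂)
open import Defs

module Congruence (n : ℕ) where

  open import Data.Integer.Divisibility.Signed using (_∣_; divides; ∣m∣n⇒∣m+n; ∣m⇒∣-m; ∣m⇒∣m*n; ∣n⇒∣m*n)
  open import Data.Integer using (_+_; _*_)

  infix 4 _≈_

  -- A record rather than a synonym, so that the implicit arguments of the ring lemmas
  -- can be inferred from a goal a ≈ b.
  record _≈_ (a b : ℤ) : Set where
    constructor congruent
    field
      divides-difference : + n ∣ a - b

  ∣⇒≈0 : ∀ {a} → + n ∣ a → a ≈ 0ℤ
  ∣⇒≈0 {a} = congruent ∘ subst (+ n ∣_) (sym (ℤP.+-identityʳ a))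

  ≈0⇒∣ : ∀ {a} → a ≈ 0ℤ → + n ∣ a
  ≈0⇒∣ {a} (congruent n∣a-0) = subst (+ n ∣_) (ℤP.+-identityʳ a) n∣a-0

  ≡⇒≈ : ∀ {a b} → a ≡ b → a ≈ b
  ≡⇒≈ {a} refl = congruent (subst (+ n ∣_) (sym (ℤP.+-inverseʳ a)) (divides 0ℤ refl))

  private
    ≈-sym : ∀ {a b} → a ≈ b → b ≈ a
    ≈-sym {a} {b} (congruent h) = congruent (subst (+ n ∣_) (lemma a b) (∣m⇒∣-m h))
      where
      lemma : ∀ a b → - (a - b) ≡ b - a
      lemma = solve-∀

    ≈-trans : ∀ {a b c} → a ≈ b → b ≈ c → a ≈ c
    ≈-trans {a} {b} {c} (congruent h) (congruent k) = congruent (subst (+ n ∣_) (lemma a b c) (∣m∣n⇒∣m+n h k))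
      where
      lemma : ∀ a b c → (a - b) + (b - c) ≡ a - c
      lemma = solve-∀

    +-cong : ∀ {a b c d} → a ≈ b → c ≈ d → a + c ≈ b + d
    +-cong {a} {b} {c} {d} (congruent h) (congruent k) = congruent (subst (+ n ∣_) (lemma a b c d) (∣m∣n⇒∣m+n h k))
      where
      lemma : ∀ a b c d → (a - b) + (c - d) ≡ (a + c) - (b + d)
      lemma = solve-∀

    *-cong : ∀ {a b c d} → a ≈ b → c ≈ d → a * c ≈ b * d
    *-cong {a} {b} {c} {d} (congruent h) (congruent k) =
      congruent (subst (+ n ∣_) (lemma a b c d) (∣m∣n⇒∣m+n (∣m⇒∣m*n c h) (∣n⇒∣m*n b k)))
      where
      lemma : ∀ a b c d → (a - b) * c + b * (c - d) ≡ a * c - b * d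
      lemma = solve-∀

    neg-cong : ∀ {a b} → a ≈ b → - a ≈ - b
    neg-cong {a} {b} (congruent h) = congruent (subst (+ n ∣_) (lemma a b) (∣m⇒∣-m h))
      where
      lemma : ∀ a b → - (a - b) ≡ - a - - b
      lemma = solve-∀

  isCommutativeRing : IsCommutativeRing _≈_ _+_ _*_ -_ 0ℤ 1ℤ
  isCommutativeRing = record
    { isRing = record
      { +-isAbelianGroup = record
        { isGroup = record
          { isMonoid = record
            { isSemigroup = record
              { isMagma = record
                { isEquivalence = record
                  { refl = λ {a} → ≡⇒≈ {a} refl
                  ; sym = λ {a b} → ≈-sym {a} {b}
                  ; trans = λ {a b c} → ≈-trans {a} {b} {c} }
                ; ∙-cong = λ {a b c d} → +-cong {a} {b} {c} {d} }
              ; assoc = λ a b c → ≡⇒≈ (ℤP.+-assoc a b c) }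
            ; identity = (λ a → ≡⇒≈ (ℤP.+-identityˡ a)) , (λ a → ≡⇒≈ (ℤP.+-identityʳ a)) }
          ; inverse = (λ a → ≡⇒≈ (ℤP.+-inverseˡ a)) , (λ a → ≡⇒≈ (ℤP.+-inverseʳ a))
          ; ⁻¹-cong = λ {a b} → neg-cong {a} {b} }
        ; comm = λ a b → ≡⇒≈ (ℤP.+-comm a b) }
      ; *-cong = λ {a b c d} → *-cong {a} {b} {c} {d}
      ; *-assoc = λ a b c → ≡⇒≈ (ℤP.*-assoc a b c)
      ; *-identity = (λ a → ≡⇒≈ (ℤP.*-identityˡ a)) , (λ a → ≡⇒≈ (ℤP.*-identityʳ a))
      ; distrib = (λ a b c → ≡⇒≈ (ℤP.*-distribˡ-+ a b c)) , (λ a b c → ≡⇒≈ (ℤP.*-distribʳ-+ a b c)) }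
    ; *-comm = λ a b → ≡⇒≈ (ℤP.*-comm a b) }

  ℤmod : CommutativeRing 0ℓ 0ℓ
  ℤmod = record { isCommutativeRing = isCommutativeRing }

module Fermat where

  open import Data.Integer.Divisibility.Signed using (_∣_; ∣ᵤ⇒∣; ∣m⇒∣m*n)
  open import Data.Nat using (_!)
  open import Data.Nat.Properties using (_!*_!≢0)
  open import Data.Nat.Divisibility as ℕ∣ using () renaming (_∣_ to _∣ℕ_)
  open import Data.Nat.DivMod using (_%_; _/_; m≡m%n+[m/n]*n; m/n*n≡m)
  open import Data.Nat.Combinatorics using (_C_; nCk≡n!/k![n-k]!; k![n∸k]!∣n!; nCn≡1)
  open import Data.Nat.Primality using (Prime; euclidsLemma; prime⇒nonTrivial)
  open import Data.Fin as Fin using (Fin; toℕ; inject₁; fromℕ)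
  open import Data.Fin.Properties using (toℕ-inject₁; toℕ<n; toℕ-fromℕ)
  open import Data.Sum using (inj₁; inj₂)
  open import Data.Vec.Functional using (init; tail; last)
  open import Relation.Nullary using (contradiction)

  prime⇒>1 : ∀ {p} → Prime p → 1 ℕ.< p
  prime⇒>1 {p} pr = ℕ.nonTrivial⇒n>1 p {{prime⇒nonTrivial pr}}

  prime∣n!⇒p≤n : ∀ {p} → Prime p → ∀ n → p ∣ℕ n ! → p ℕ.≤ n
  prime∣n!⇒p≤n pr zero p∣1 = contradiction (ℕ∣.∣1⇒≡1 p∣1) (ℕP.>⇒≢ (prime⇒>1 pr))
  prime∣n!⇒p≤n pr (suc n) p∣[n+1]! with euclidsLemma (suc n) (n !) pr p∣[n+1]!
  ... | inj₁ p∣n+1 = ℕ∣.∣⇒≤ p∣n+1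
  ... | inj₂ p∣n! = ℕP.m≤n⇒m≤1+n (prime∣n!⇒p≤n pr n p∣n!)

  nCk*k![n∸k]!≡n! : ∀ {n k} → k ℕ.≤ n → (n C k) ℕ.* (k ! ℕ.* (n ∸ k) !) ≡ n !
  nCk*k![n∸k]!≡n! {n} {k} k≤n = trans (cong (ℕ._* (k ! ℕ.* (n ∸ k) !)) (nCk≡n!/k![n-k]! k≤n))
    (m/n*n≡m {{k !* (n ∸ k) !≢0}} (k![n∸k]!∣n! k≤n))

  prime∣nCk : ∀ {p k} → Prime p → 0 ℕ.< k → k ℕ.< p → p ∣ℕ p C k
  prime∣nCk {suc q} {k} pr 0<k k<p
    with euclidsLemma (suc q C k) (k ! ℕ.* (suc q ∸ k) !) pr
           (subst (suc q ∣ℕ_) (sym (nCk*k![n∸k]!≡n! (ℕP.<⇒≤ k<p))) (ℕ∣.m∣m*n (q !)))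
  ... | inj₁ p∣C = p∣C
  ... | inj₂ p∣k![p∸k]! with euclidsLemma (k !) ((suc q ∸ k) !) pr p∣k![p∸k]!
  ...   | inj₁ p∣k! = contradiction (prime∣n!⇒p≤n pr k p∣k!) (ℕP.<⇒≱ k<p)
  ...   | inj₂ p∣[p∸k]! = contradiction (prime∣n!⇒p≤n pr (suc q ∸ k) p∣[p∸k]!)
                            (ℕP.<⇒≱ (ℕP.∸-monoʳ-< 0<k (ℕP.<⇒≤ k<p)))

  module _ {q : ℕ} (pr : Prime (suc (suc q))) where

    private
      p : ℕ
      p = suc (suc q)

    open Congruence p
    open import Data.Integer using (_+_; _*_; _^_)
    open CommutativeRing ℤmod using (+-cong; setoid; commutativeSemiring; semiring; +-congˡ; +-congʳ; +-identityˡ; *-identityˡ; *-identityʳ; +-comm; *-congˡ) renaming (refl to ≈-refl; trans to ≈-trans′)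
    open import Algebra.Properties.CommutativeSemiring.Binomial commutativeSemiring using (theorem; binomial; binomialTerm)
    open import Algebra.Properties.Semiring.Sum semiring using (sum; sum-init-last; sum-cong-≋; sum-replicate-zero)
    open import Algebra.Properties.Semiring.Mult semiring using (_×_; ×-homo-1)
    open import Algebra.Properties.Semiring.Exp semiring using () renaming (_^_ to _^ᴿ_)
    open import Relation.Binary.Reasoning.Setoid setoid

    ×≡* : ∀ c z → c × z ≡ + c * z
    ×≡* zero z = sym (ℤP.*-zeroˡ z)
    ×≡* (suc c) z = trans (cong (_+_ z) (×≡* c z)) (sym (ℤP.suc-* (+ c) z))

    ^ᴿ≡^ : ∀ x k → x ^ᴿ k ≡ x ^ k
    ^ᴿ≡^ x zero = refl
    ^ᴿ≡^ x (suc k) = cong (x *_) (^ᴿ≡^ x k)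

    multiple×≈0 : ∀ {c} z → p ∣ℕ c → c × z ≈ 0ℤ
    multiple×≈0 {c} z p∣c = ∣⇒≈0 (subst (+ p ∣_) (sym (×≡* c z)) (∣m⇒∣m*n z (∣ᵤ⇒∣ {+ p} {+ c} p∣c)))

    freshmanᴿ : ∀ x y → (x + y) ^ᴿ p ≈ x ^ᴿ p + y ^ᴿ p
    freshmanᴿ x y = begin
      (x + y) ^ᴿ p                                          ≈⟨ theorem p x y ⟩
      f Fin.zero + sum (tail f)                             ≈⟨ +-congˡ {f Fin.zero} (sum-init-last (tail f)) ⟩
      f Fin.zero + (sum (init (tail f)) + last (tail f))    ≈⟨ +-congˡ {f Fin.zero} (+-congʳ {last (tail f)} middle≈0) ⟩
      f Fin.zero + (0ℤ + last (tail f))                     ≈⟨ +-cong first≈ (≈-trans′ (+-identityˡ _) last≈) ⟩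
      y ^ᴿ p + x ^ᴿ p                                       ≈⟨ +-comm (y ^ᴿ p) (x ^ᴿ p) ⟩
      x ^ᴿ p + y ^ᴿ p                                       ∎
      where
      f = binomialTerm x y p
      first≈ : f Fin.zero ≈ y ^ᴿ p
      first≈ = ≈-trans′ (×-homo-1 _) (*-identityˡ _)
      last≈ : last (tail f) ≈ x ^ᴿ p
      last≈ = begin
        f (fromℕ p)                              ≡⟨ cong (λ j → (p C j) × (x ^ᴿ j * y ^ᴿ (p ∸ j))) (toℕ-fromℕ p) ⟩
        (p C p) × (x ^ᴿ p * y ^ᴿ (p ∸ p))        ≡⟨ cong₂ (λ c e → c × (x ^ᴿ p * y ^ᴿ e)) (nCn≡1 p) (ℕP.n∸n≡0 p) ⟩
        1 × (x ^ᴿ p * 1ℤ)                        ≈⟨ ×-homo-1 _ ⟩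
        x ^ᴿ p * 1ℤ                              ≈⟨ *-identityʳ _ ⟩
        x ^ᴿ p                                   ∎
      middle≈0 : sum (init (tail f)) ≈ 0ℤ
      middle≈0 = ≈-trans′
        (sum-cong-≋ λ i → multiple×≈0 (binomial x y p (Fin.suc (inject₁ i))) (prime∣nCk pr ℕ.z<s (ℕ.s<s (inner< i))))
        (sum-replicate-zero (suc q))
        where
        inner< : (i : Fin (suc q)) → toℕ (inject₁ i) ℕ.< suc q
        inner< i = subst (ℕ._< suc q) (sym (toℕ-inject₁ i)) (toℕ<n i)

    freshman : ∀ x y → (x + y) ^ p ≈ x ^ p + y ^ p
    freshman x y = subst₂ _≈_ (^ᴿ≡^ (x + y) p) (cong₂ _+_ (^ᴿ≡^ x p) (^ᴿ≡^ y p)) (freshmanᴿ x y)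

    fermat : ∀ a → (+ a) ^ p ≈ + a
    fermat zero = ≡⇒≈ (ℤP.*-zeroˡ ((+ 0) ^ suc q))
    fermat (suc a) = begin
      (1ℤ + + a) ^ p      ≈⟨ freshman 1ℤ (+ a) ⟩
      1ℤ ^ p + (+ a) ^ p  ≈⟨ +-cong (≡⇒≈ (ℤP.^-zeroˡ p)) (fermat a) ⟩
      1ℤ + + a            ∎

    ^-redExp : ∀ {x} → x ^ p ≈ x → ∀ k → x ^ k ≈ x ^ redExp p k
    ^-redExp x^p≈x zero = ≈-refl
    ^-redExp {x} x^p≈x (suc k) = begin
      x ^ suc k                                   ≡⟨ cong (λ e → x ^ suc e) (m≡m%n+[m/n]*n k (suc q)) ⟩
      x ^ suc (k % suc q ℕ.+ (k / suc q) ℕ.* suc q) ≈⟨ periodic (k / suc q) (k % suc q) ⟩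
      x ^ suc (k % suc q)                         ∎
      where
      shift : ∀ e → x ^ suc (e ℕ.+ suc q) ≈ x ^ suc e
      shift e = begin
        x ^ suc (e ℕ.+ suc q) ≡⟨ cong (x ^_) (sym (ℕP.+-suc e (suc q))) ⟩
        x ^ (e ℕ.+ p)         ≡⟨ ℤP.^-distribˡ-+-* x e p ⟩
        x ^ e * x ^ p         ≈⟨ *-congˡ {x ^ e} x^p≈x ⟩
        x ^ e * x             ≡⟨ ℤP.*-comm (x ^ e) x ⟩
        x ^ suc e             ∎
      periodic : ∀ t r → x ^ suc (r ℕ.+ t ℕ.* suc q) ≈ x ^ suc r
      periodic zero r = ≡⇒≈ (cong (λ e → x ^ suc e) (ℕP.+-identityʳ r))
      periodic (suc t) r = begin
        x ^ suc (r ℕ.+ suc t ℕ.* suc q)           ≡⟨ cong (λ e → x ^ suc e) regroup ⟩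
        x ^ suc (r ℕ.+ t ℕ.* suc q ℕ.+ suc q)     ≈⟨ shift (r ℕ.+ t ℕ.* suc q) ⟩
        x ^ suc (r ℕ.+ t ℕ.* suc q)               ≈⟨ periodic t r ⟩
        x ^ suc r                                 ∎
        where
        regroup : r ℕ.+ suc t ℕ.* suc q ≡ r ℕ.+ t ℕ.* suc q ℕ.+ suc q
        regroup = trans (cong (r ℕ.+_) (ℕP.+-comm (suc q) (t ℕ.* suc q))) (sym (ℕP.+-assoc r (t ℕ.* suc q) (suc q)))

module Evaluation where

  open import Data.Integer using (_+_; _*_; _^_; _-_)
  open import Data.Fin using (Fin; zero; suc)
  open import Data.Vec as Vec using (Vec; []; _∷_)
  open import Data.List as List using (List; []; _∷_; _++_)

  monomial : ∀ {k} → Vec ℕ k → (Fin k → ℤ) → ℤ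
  monomial []       x = 1ℤ
  monomial (e ∷ es) x = x zero ^ e * monomial es (x ∘ suc)

  monomial-zipWith-+ : ∀ {k} (a b : Vec ℕ k) x → monomial (Vec.zipWith ℕ._+_ a b) x ≡ monomial a x * monomial b x
  monomial-zipWith-+ []       []       x = refl
  monomial-zipWith-+ (a ∷ as) (b ∷ bs) x = trans
    (cong₂ _*_ (ℤP.^-distribˡ-+-* (x zero) a b) (monomial-zipWith-+ as bs (x ∘ suc)))
    (interchange (x zero ^ a) (x zero ^ b) _ _)
    where
    interchange : ∀ a b c d → (a * b) * (c * d) ≡ (a * c) * (b * d)
    interchange = solve-∀

  monomial-zero : ∀ k x → monomial (Vec.replicate k 0) x ≡ 1ℤ
  monomial-zero zero    x = refl
  monomial-zero (suc k) x = trans (ℤP.*-identityˡ _) (monomial-zero k (x ∘ suc))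

  monomial-unitExp : ∀ {k} (i : Fin k) x → monomial (unitExp i) x ≡ x i
  monomial-unitExp {suc k} zero    x = trans (cong₂ _*_ (ℤP.*-identityʳ (x zero)) (monomial-zero k (x ∘ suc))) (ℤP.*-identityʳ (x zero))
  monomial-unitExp {suc k} (suc i) x = trans (ℤP.*-identityˡ _) (monomial-unitExp i (x ∘ suc))

  module _ {n m : ℕ} (x : Fin n → ℤ) (y : Fin m → ℤ) where

    evalTerm : Term n m → ℤ
    evalTerm (c , a , b) = c * (monomial a x * monomial b y)

    eval : Poly n m → ℤ
    eval P = List.foldr _+_ 0ℤ (List.map evalTerm P)

    eval-++ : ∀ P Q → eval (P ++ Q) ≡ eval P + eval Q
    eval-++ []      Q = sym (ℤP.+-identityˡ (eval Q))
    eval-++ (t ∷ P) Q = trans (cong (_+_ (evalTerm t)) (eval-++ P Q)) (sym (ℤP.+-assoc (evalTerm t) (eval P) (eval Q)))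

    eval-neg : ∀ P → eval (neg P) ≡ - eval P
    eval-neg []              = refl
    eval-neg ((c , a , b) ∷ P) = trans
      (cong₂ _+_ (sym (ℤP.neg-distribˡ-* c _)) (eval-neg P))
      (sym (ℤP.neg-distrib-+ (evalTerm (c , a , b)) (eval P)))

    eval-⊖ : ∀ P Q → eval (P ⊖ Q) ≡ eval P - eval Q
    eval-⊖ P Q = trans (eval-++ P (neg Q)) (cong (_+_ (eval P)) (eval-neg Q))

    private
      mulTerm : Term n m → Term n m → Term n m
      mulTerm (c , a , b) (d , a′ , b′) = (c * d , Vec.zipWith ℕ._+_ a a′ , Vec.zipWith ℕ._+_ b b′)

      evalTerm-mulTerm : ∀ t s → evalTerm (mulTerm t s) ≡ evalTerm t * evalTerm s
      evalTerm-mulTerm (c , a , b) (d , a′ , b′) = trans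
        (cong (_*_ (c * d)) (cong₂ _*_ (monomial-zipWith-+ a a′ x) (monomial-zipWith-+ b b′ y)))
        (regroup c d (monomial a x) (monomial b y) (monomial a′ x) (monomial b′ y))
        where
        regroup : ∀ c d A B A′ B′ → (c * d) * ((A * A′) * (B * B′)) ≡ (c * (A * B)) * (d * (A′ * B′))
        regroup = solve-∀

      eval-map-mulTerm : ∀ t Q → eval (List.map (mulTerm t) Q) ≡ evalTerm t * eval Q
      eval-map-mulTerm t []      = sym (ℤP.*-zeroʳ (evalTerm t))
      eval-map-mulTerm t (s ∷ Q) = trans
        (cong₂ _+_ (evalTerm-mulTerm t s) (eval-map-mulTerm t Q))
        (sym (ℤP.*-distribˡ-+ (evalTerm t) (evalTerm s) (eval Q)))

    eval-⊗ : ∀ P Q → eval (P ⊗ Q) ≡ eval P * eval Q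
    eval-⊗ []      Q = refl
    eval-⊗ (t ∷ P) Q = trans (eval-++ (List.map (mulTerm t) Q) (P ⊗ Q))
      (trans (cong₂ _+_ (eval-map-mulTerm t Q) (eval-⊗ P Q)) (sym (ℤP.*-distribʳ-+ (eval Q) (evalTerm t) (eval P))))

    eval-const : ∀ c → eval (const c) ≡ c
    eval-const c = trans (ℤP.+-identityʳ _)
      (trans (cong (_*_ c) (cong₂ _*_ (monomial-zero n x) (monomial-zero m y))) (ℤP.*-identityʳ c))

    eval-prodP : ∀ Ps → eval (prodP Ps) ≡ List.foldr _*_ 1ℤ (List.map eval Ps)
    eval-prodP []       = eval-const 1ℤ
    eval-prodP (Q ∷ Ps) = trans (eval-⊗ Q (prodP Ps)) (cong (_*_ (eval Q)) (eval-prodP Ps))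

    eval-var-v : ∀ i → eval (var-v i) ≡ x i
    eval-var-v i = trans (ℤP.+-identityʳ _) (trans (ℤP.*-identityˡ _)
      (trans (cong₂ _*_ (monomial-unitExp i x) (monomial-zero m y)) (ℤP.*-identityʳ (x i))))

    eval-var-e : ∀ j → eval (var-e j) ≡ y j
    eval-var-e j = trans (ℤP.+-identityʳ _) (trans (ℤP.*-identityˡ _)
      (trans (cong₂ _*_ (monomial-zero n x) (monomial-unitExp j y)) (ℤP.*-identityˡ (y j))))

module ListFilter where

  open import Data.List using (_∷_; []; filter)
  open import Data.List.Properties using (filter-reject)
  open import Relation.Nullary using (yes; no)
  open import Relation.Unary using (Pred; Decidable)

  filter-filter-⊆ : ∀ {a p q} {A : Set a} {P : Pred A p} {Q : Pred A q} (P? : Decidable P) (Q? : Decidable Q) →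
                    (∀ {x} → P x → Q x) → ∀ xs → filter P? (filter Q? xs) ≡ filter P? xs
  filter-filter-⊆ P? Q? P⊆Q []       = refl
  filter-filter-⊆ P? Q? P⊆Q (x ∷ xs) with Q? x
  ... | no ¬qx = trans (filter-filter-⊆ P? Q? P⊆Q xs) (sym (filter-reject P? (¬qx ∘ P⊆Q)))
  ... | yes _ with P? x
  ...   | yes _ = cong (x ∷_) (filter-filter-⊆ P? Q? P⊆Q xs)
  ...   | no _  = filter-filter-⊆ P? Q? P⊆Q xs

module ClassSums {c ℓ a k} (S : Semiring c ℓ) {A : Set a} {K : Set k} (_≟_ : DecidableEquality K)
                 (key : A → K) (w : A → Semiring.Carrier S) (f : K → Semiring.Carrier S) where

  open import Data.List using (List; []; _∷_; foldr; map; filter)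
  open import Data.List.Properties using (filter-none)
  open import Data.List.Membership.Propositional using (_∈_)
  open import Data.List.Membership.Propositional.Properties using (∈-filter⁻; ∈-map⁺; ∈-map⁻)
  open import Data.List.Relation.Unary.Any using (here; there; satisfied)
  open import Data.List.Relation.Unary.All using (all?; lookup)
  open import Data.List.Relation.Unary.All.Properties using (all-filter; ¬All⇒Any¬)
  open import Data.Product using (∃; _,_)
  open import Relation.Nullary using (¬_; Dec; yes; no; contradiction)
  open import Relation.Nullary.Decidable using (¬?)
  import Algebra.Properties.CommutativeSemigroup as CommSemigroupProperties
  open ListFilter using (filter-filter-⊆)

  open Semiring S renaming (refl to ≈-refl; sym to ≈-sym; trans to ≈-trans)
  open CommSemigroupProperties +-commutativeSemigroup using (x∙yz≈y∙xz)
  open import Relation.Binary.Reasoning.Setoid setoid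

  classSum : K → List A → Carrier
  classSum k xs = foldr _+_ 0# (map w (filter (λ a → key a ≟ k) xs))

  dropClass : K → List A → List A
  dropClass k = filter (λ a → ¬? (key a ≟ k))

  weightedSum : List A → Carrier
  weightedSum xs = foldr _+_ 0# (map (λ a → w a * f (key a)) xs)

  weightedSum-split : ∀ k xs → weightedSum xs ≈ classSum k xs * f k + weightedSum (dropClass k xs)
  weightedSum-split k [] = ≈-sym (≈-trans (+-identityʳ _) (zeroˡ (f k)))
  weightedSum-split k (b ∷ xs) with key b ≟ k
  ... | yes refl = begin
    w b * f (key b) + weightedSum xs                                  ≈⟨ +-congˡ (weightedSum-split (key b) xs) ⟩
    w b * f (key b) + (classSum (key b) xs * f (key b) + weightedSum (dropClass (key b) xs)) ≈⟨ ≈-sym (+-assoc _ _ _) ⟩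
    (w b * f (key b) + classSum (key b) xs * f (key b)) + weightedSum (dropClass (key b) xs) ≈⟨ +-congʳ (≈-sym (distribʳ _ _ _)) ⟩
    (w b + classSum (key b) xs) * f (key b) + weightedSum (dropClass (key b) xs) ∎
  ... | no _ = ≈-trans (+-congˡ (weightedSum-split k xs)) (x∙yz≈y∙xz _ _ _)

  classSum-dropClass-self : ∀ k xs → classSum k (dropClass k xs) ≡ 0#
  classSum-dropClass-self k xs =
    cong (foldr _+_ 0# ∘ map w) (filter-none (λ a → key a ≟ k) (all-filter (λ a → ¬? (key a ≟ k)) xs))

  classSum-dropClass-other : ∀ {k k′} → k′ ≢ k → ∀ xs → classSum k′ (dropClass k xs) ≡ classSum k′ xs
  classSum-dropClass-other {k} {k′} k′≢k xs = cong (foldr _+_ 0# ∘ map w)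
    (filter-filter-⊆ (λ a → key a ≟ k′) (λ a → ¬? (key a ≟ k)) (λ { refl → k′≢k }) xs)

  private
    vanishes-over : ∀ ks xs → (∀ a → a ∈ xs → key a ∈ ks) → (∀ k → k ∈ ks → classSum k xs ≈ 0#) →
                    weightedSum xs ≈ 0#
    vanishes-over []       []      covered zeros = ≈-refl
    vanishes-over []       (b ∷ _) covered zeros with () ← covered b (here refl)
    vanishes-over (k ∷ ks) xs      covered zeros = begin
      weightedSum xs                                  ≈⟨ weightedSum-split k xs ⟩
      classSum k xs * f k + weightedSum (dropClass k xs) ≈⟨ +-cong (≈-trans (*-congʳ (zeros k (here refl))) (zeroˡ (f k)))
                                                                    (vanishes-over ks (dropClass k xs) covered′ zeros′) ⟩
      0# + 0#                                         ≈⟨ +-identityˡ 0# ⟩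
      0#                                              ∎
      where
      covered′ : ∀ a → a ∈ dropClass k xs → key a ∈ ks
      covered′ a a∈ with ∈-filter⁻ (λ a → ¬? (key a ≟ k)) a∈
      ... | a∈xs , key≢k with covered a a∈xs
      ...   | here key≡k = contradiction key≡k key≢k
      ...   | there key∈ks = key∈ks
      zeros′ : ∀ k′ → k′ ∈ ks → classSum k′ (dropClass k xs) ≈ 0#
      zeros′ k′ k′∈ks with k′ ≟ k
      ... | yes refl = reflexive (classSum-dropClass-self k xs)
      ... | no k′≢k = ≈-trans (reflexive (classSum-dropClass-other k′≢k xs)) (zeros k′ (there k′∈ks))

  weightedSum-vanishes : ∀ xs → (∀ a → a ∈ xs → classSum (key a) xs ≈ 0#) → weightedSum xs ≈ 0#
  weightedSum-vanishes xs zeros = vanishes-over (map key xs) xs (λ a → ∈-map⁺ key) zeros′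
    where
    zeros′ : ∀ k → k ∈ map key xs → classSum k xs ≈ 0#
    zeros′ k k∈ with ∈-map⁻ key k∈
    ... | a , a∈xs , refl = zeros a a∈xs

  nonzero-classSum : (∀ z → Dec (z ≈ 0#)) → ∀ xs → ¬ weightedSum xs ≈ 0# → ∃ λ k → ¬ classSum k xs ≈ 0#
  nonzero-classSum zero? xs W≉0 with all? (λ a → zero? (classSum (key a) xs)) xs
  ... | yes allZero = contradiction (weightedSum-vanishes xs (λ a → lookup allZero)) W≉0
  ... | no ¬allZero with satisfied (¬All⇒Any¬ (λ a → zero? (classSum (key a) xs)) xs ¬allZero)
  ...   | a , ≉0 = key a , ≉0

module Colouring where

  open import Data.Nat using (_≤_; _<_; z≤n; s≤s; _≟_)
  open import Data.Fin as Fin using (Fin; toℕ)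
  open import Data.Fin.Properties using (toℕ<n)
  open import Data.List using (List; filter; length; map; allFin)
  open import Data.List.Properties using (filter-notAll; length-map; length-filter; length-tabulate; foldr-forcesᵇ; foldr-preservesᵇ)
  open import Data.List.Membership.Propositional using (_∈_; _∉_)
  open import Data.List.Membership.Propositional.Properties using (∈-filter⁺; ∈-map⁺; ∈-allFin)
  open import Data.List.Membership.DecPropositional _≟_ using (_∈?_)
  import Data.List.Relation.Unary.Any as Any
  open import Data.List.Relation.Unary.All as All using (All)
  import Data.List.Relation.Unary.All.Properties as All
  open import Data.Vec as Vec using ()
  import Data.Vec.Relation.Unary.Any as VecAny
  open import Data.Vec.Relation.Unary.Any.Properties using (lookup-index)
  open import Data.Product using (Σ; ∃; _×_; _,_; proj₁; proj₂)
  open import Data.Sum using (inj₁; inj₂)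
  open import Relation.Nullary using (yes; no; contradiction)
  open import Relation.Nullary.Decidable using (¬?)

  missing-colour : ∀ N (L : List ℕ) → length L < N → ∃ λ c → 1 ≤ c × c ≤ N × c ∉ L
  missing-colour (suc N) L |L|<1+N with suc N ∈? L
  ... | no 1+N∉L = suc N , s≤s z≤n , ℕP.≤-refl , 1+N∉L
  ... | yes 1+N∈L
    with missing-colour N (filter (λ c → ¬? (c ≟ suc N)) L)
           (ℕP.<-≤-trans (filter-notAll (λ c → ¬? (c ≟ suc N)) L (Any.map (λ eq ne → ne (sym eq)) 1+N∈L))
                         (ℕP.≤-pred |L|<1+N))
  ...   | c , 1≤c , c≤N , c∉L′ =
          c , 1≤c , ℕP.m≤n⇒m≤1+n c≤N , λ c∈L → c∉L′ (∈-filter⁺ (λ c → ¬? (c ≟ suc N)) c∈L (ℕP.<⇒≢ (s≤s c≤N)))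

  module Greedy {n : ℕ} (Δ : ℕ) (earlier : Fin n → List (Fin n)) (bounded : ∀ j → length (earlier j) ≤ Δ) where

    private
      fresh : (c : Fin n → ℕ) (j : Fin n) → ∃ λ c′ → 1 ≤ c′ × c′ ≤ suc Δ × c′ ∉ map c (earlier j)
      fresh c j = missing-colour (suc Δ) (map c (earlier j)) (s≤s (ℕP.≤-trans (ℕP.≤-reflexive (length-map c (earlier j))) (bounded j)))

      stage : ℕ → Fin n → ℕ
      stage zero    j = 0
      stage (suc s) j with toℕ j ≟ s
      ... | yes _ = proj₁ (fresh (stage s) j)
      ... | no _  = stage s j

      record ProperUpTo (s : ℕ) : Set where
        field
          in-range : ∀ j → toℕ j < s → 1 ≤ stage s j × stage s j ≤ suc Δ
          distinct : ∀ i j → toℕ i < toℕ j → toℕ j < s → i ∈ earlier j → stage s i ≢ stage s j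

      proper : ∀ s → ProperUpTo s
      proper zero    = record { in-range = λ _ () ; distinct = λ _ _ _ () }
      proper (suc s) = record { in-range = in-range′ ; distinct = distinct′ }
        where
        open ProperUpTo (proper s)
        in-range′ : ∀ j → toℕ j < suc s → 1 ≤ stage (suc s) j × stage (suc s) j ≤ suc Δ
        in-range′ j j≤s with toℕ j ≟ s
        ... | yes _  = let _ , 1≤c , c≤1+Δ , _ = fresh (stage s) j in 1≤c , c≤1+Δ
        ... | no j≢s = in-range j (ℕP.≤∧≢⇒< (ℕP.≤-pred j≤s) j≢s)
        distinct′ : ∀ i j → toℕ i < toℕ j → toℕ j < suc s → i ∈ earlier j → stage (suc s) i ≢ stage (suc s) j
        distinct′ i j i<j j≤s i∈ with toℕ i ≟ s | toℕ j ≟ s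
        ... | yes i≡s | _      = contradiction (subst (toℕ j ≤_) (sym i≡s) (ℕP.≤-pred j≤s)) (ℕP.<⇒≱ i<j)
        ... | no _    | yes _  = λ eq → proj₂ (proj₂ (proj₂ (fresh (stage s) j))) (subst (_∈ map (stage s) (earlier j)) eq (∈-map⁺ (stage s) i∈))
        ... | no _    | no j≢s = distinct i j i<j (ℕP.≤∧≢⇒< (ℕP.≤-pred j≤s) j≢s) i∈

    greedyColouring : Σ (Fin n → ℕ) λ c → (∀ j → 1 ≤ c j × c j ≤ suc Δ) ×
                                         (∀ i j → toℕ i < toℕ j → i ∈ earlier j → c i ≢ c j)
    greedyColouring = stage n , (λ j → in-range j (toℕ<n j)) , (λ i j i<j → distinct i j i<j (toℕ<n j))
      where open ProperUpTo (proper n)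

  otherEnd : ∀ {n} → Fin n → Fin n × Fin n → Fin n
  otherEnd v (a , b) with a Fin.≟ v
  ... | yes _ = b
  ... | no _  = a

  module _ {n m : ℕ} (E : Edges n m) where

    otherEnds : Fin n → List (Fin n)
    otherEnds j = map (otherEnd j ∘ Vec.lookup E) (incEdges E j)

    adjacent∈otherEnds : ∀ {i j} → i ≢ j → Adj E i j → i ∈ otherEnds j
    adjacent∈otherEnds {i} {j} i≢j adj =
      subst (_∈ otherEnds j) otherEnd≡i (∈-map⁺ (otherEnd j ∘ Vec.lookup E) (∈-filter⁺ (incident? E j) (∈-allFin k) k-incident))
      where
      k = VecAny.index adj
      k-incident : Incident E j k
      k-incident with lookup-index adj
      ... | inj₁ (_ , b≡j) = inj₂ b≡j
      ... | inj₂ (a≡j , _) = inj₁ a≡j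
      otherEnd≡i : otherEnd j (Vec.lookup E k) ≡ i
      otherEnd≡i with Vec.lookup E k | lookup-index adj
      ... | a , b | inj₁ (a≡i , b≡j) with a Fin.≟ j
      ...   | yes a≡j = contradiction (trans (sym a≡i) a≡j) i≢j
      ...   | no _    = a≡i
      otherEnd≡i | a , b | inj₂ (a≡j , b≡i) with a Fin.≟ j
      ...   | yes _   = b≡i
      ...   | no a≢j  = contradiction a≡j a≢j

    degree≤maxDegree : ∀ j → degree E j ≤ maxDegree E
    degree≤maxDegree j = All.lookup (All.map⁻ degrees≤) (∈-allFin j)
      where
      degrees≤ : All (_≤ maxDegree E) (map (degree E) (allFin n))
      degrees≤ = foldr-forcesᵇ (λ x y x⊔y≤ → ℕP.m⊔n≤o⇒m≤o x y x⊔y≤ , ℕP.m⊔n≤o⇒n≤o x y x⊔y≤) 0 _ ℕP.≤-refl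

    maxDegree≤m : maxDegree E ≤ m
    maxDegree≤m = foldr-preservesᵇ {P = _≤ m} ℕP.⊔-lub z≤n (All.map⁺ (All.universal degree≤m (allFin n)))
      where
      degree≤m : ∀ j → degree E j ≤ m
      degree≤m j = ℕP.≤-trans (length-filter (incident? E j) (allFin m)) (ℕP.≤-reflexive (length-tabulate (λ k → k)))

    colouring : Σ (Fin n → ℕ) λ c → (∀ j → 1 ≤ c j × c j ≤ suc (maxDegree E)) ×
                                   (∀ i j → toℕ i < toℕ j → Adj E i j → c i ≢ c j)
    colouring with Greedy.greedyColouring (maxDegree E) otherEnds
                     (λ j → ℕP.≤-trans (ℕP.≤-reflexive (length-map _ (incEdges E j))) (degree≤maxDegree j))
    ... | c , in-range , distinct =
          c , in-range , λ i j i<j adj → distinct i j i<j (adjacent∈otherEnds (ℕP.<⇒≢ i<j ∘ cong toℕ) adj)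

module Nonvanishing where

  open import Data.Integer using (_*_; _-_)
  open import Data.Integer.Divisibility using () renaming (_∣_ to _∣ᵤ_)
  open import Data.Nat using (_<_; z≤n; s≤s)
  open import Data.Nat.Divisibility as ℕ∣ using () renaming (_∣_ to _∣ℕ_)
  open import Data.Nat.Primality using (Prime; euclidsLemma)
  open import Data.Fin using (Fin)
  open import Data.List using ([]; _∷_; map)
  open import Data.List.Membership.Propositional using (_∈_)
  open import Data.List.Relation.Unary.Any using (here; there)
  open import Data.Sum using (inj₁; inj₂)
  open import Relation.Nullary using (¬_)
  open Fermat using (prime⇒>1)
  open Evaluation

  small-positive-not-multiple : ∀ {p d} → 0 < d → d < p → ¬ p ∣ℕ d
  small-positive-not-multiple {d = suc _} _ d<p p∣d = ℕP.<⇒≱ d<p (ℕ∣.∣⇒≤ p∣d)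

  distinct-residues : ∀ {p a b} → a ≢ b → a < p → b < p → ¬ + p ∣ᵤ + a - + b
  distinct-residues {p} {a} {b} a≢b a<p b<p =
    small-positive-not-multiple 0<∣a⊖b∣ (ℕP.≤-<-trans (ℤP.∣m⊝n∣≤m⊔n a b) (ℕP.⊔-lub a<p b<p))
    ∘ subst (p ∣ℕ_) (cong ∣_∣ (ℤP.[+m]-[+n]≡m⊖n a b))
    where
    0<∣a⊖b∣ : 0 < ∣ a ℤ.⊖ b ∣
    0<∣a⊖b∣ with ℕP.≤-total a b
    ... | inj₁ a≤b = subst (0 <_) (sym (ℤP.∣⊖∣-≤ a≤b)) (ℕP.m<n⇒0<n∸m (ℕP.≤∧≢⇒< a≤b a≢b))
    ... | inj₂ b≤a = subst (0 <_) (sym (trans (ℤP.∣m⊖n∣≡∣n⊖m∣ a b) (ℤP.∣⊖∣-≤ b≤a)))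
                       (ℕP.m<n⇒0<n∸m (ℕP.≤∧≢⇒< b≤a (a≢b ∘ sym)))

  module _ {p : ℕ} (pr : Prime p) where

    prime∤* : ∀ a b → ¬ + p ∣ᵤ a → ¬ + p ∣ᵤ b → ¬ + p ∣ᵤ a * b
    prime∤* a b p∤a p∤b p∣ab with euclidsLemma ∣ a ∣ ∣ b ∣ pr (subst (p ∣ℕ_) (ℤP.abs-* a b) p∣ab)
    ... | inj₁ p∣a = p∤a p∣a
    ... | inj₂ p∣b = p∤b p∣b

    module _ {n m : ℕ} (x : Fin n → ℤ) (y : Fin m → ℤ) where

      prime∤eval-⊗ : ∀ P Q → ¬ + p ∣ᵤ eval x y P → ¬ + p ∣ᵤ eval x y Q → ¬ + p ∣ᵤ eval x y (P ⊗ Q)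
      prime∤eval-⊗ P Q p∤P p∤Q = subst (λ z → ¬ + p ∣ᵤ z) (sym (eval-⊗ x y P Q)) (prime∤* (eval x y P) (eval x y Q) p∤P p∤Q)

      prime∤eval-prodP-map : ∀ {A : Set} (g : A → Poly n m) xs →
                             (∀ a → a ∈ xs → ¬ + p ∣ᵤ eval x y (g a)) → ¬ + p ∣ᵤ eval x y (prodP (map g xs))
      prime∤eval-prodP-map g [] _ =
        subst (λ z → ¬ + p ∣ᵤ z) (sym (eval-const x y 1ℤ)) (small-positive-not-multiple (s≤s z≤n) (prime⇒>1 pr))
      prime∤eval-prodP-map g (a ∷ xs) p∤ =
        prime∤eval-⊗ (g a) (prodP (map g xs)) (p∤ a (here refl)) (prime∤eval-prodP-map g xs (λ b → p∤ b ∘ there))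

module Reduction {q : ℕ} (pr : Prime (suc (suc q))) {n m : ℕ} (cx : Fin n → ℕ) (cy : Fin m → ℕ) where

  open import Data.Integer using (_*_)
  open import Data.Fin as Fin using (Fin)
  open import Data.Vec as Vec using (Vec; []; _∷_)
  import Data.Vec.Properties as VecP
  open import Data.List using ([]; _∷_; foldr; map)
  open import Relation.Nullary.Decidable using (_×-dec_)
  open import Data.List.Properties using (filter-≐)
  open import Data.Product using (_×_; _,_; proj₁; proj₂)
  open import Data.Product.Properties using (≡-dec; ×-≡,≡→≡; ×-≡,≡←≡)
  open Evaluation

  private
    p : ℕ
    p = suc (suc q)

  open Congruence p
  open CommutativeRing ℤmod using (semiring; +-cong; *-cong; *-congˡ) renaming (refl to ≈-refl)

  x : Fin n → ℤ
  x = +_ ∘ cx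

  y : Fin m → ℤ
  y = +_ ∘ cy

  reducedExponents : Term n m → Vec ℕ n × Vec ℕ m
  reducedExponents (_ , a , b) = Vec.map (redExp p) a , Vec.map (redExp p) b

  monomialValue : Vec ℕ n × Vec ℕ m → ℤ
  monomialValue (l , k) = monomial l x * monomial k y

  open ClassSums semiring (≡-dec (VecP.≡-dec ℕP._≟_) (VecP.≡-dec ℕP._≟_)) reducedExponents proj₁ monomialValue public

  monomial-reduce : ∀ {k} (a : Vec ℕ k) (v : Fin k → ℕ) → monomial a (+_ ∘ v) ≈ monomial (Vec.map (redExp p) a) (+_ ∘ v)
  monomial-reduce []       v = ≈-refl
  monomial-reduce (e ∷ es) v = *-cong (Fermat.^-redExp pr (Fermat.fermat pr (v Fin.zero)) e) (monomial-reduce es (v ∘ Fin.suc))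

  eval≈weightedSum : ∀ P → eval x y P ≈ weightedSum P
  eval≈weightedSum []                = ≈-refl
  eval≈weightedSum ((c , a , b) ∷ P) =
    +-cong (*-congˡ {c} (*-cong (monomial-reduce a cx) (monomial-reduce b cy))) (eval≈weightedSum P)

  coeffRed≡classSum : ∀ P l k → coeffRed p P l k ≡ classSum (l , k) P
  coeffRed≡classSum P l k = cong (foldr ℤ._+_ 0ℤ ∘ map proj₁)
    (filter-≐ (λ t → VecP.≡-dec ℕP._≟_ (proj₁ (reducedExponents t)) l ×-dec VecP.≡-dec ℕP._≟_ (proj₂ (reducedExponents t)) k)
              (λ t → ≡-dec (VecP.≡-dec ℕP._≟_) (VecP.≡-dec ℕP._≟_) (reducedExponents t) (l , k))
              (×-≡,≡→≡ , ×-≡,≡←≡) P)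

module Bounds where

  open import Data.Nat using (_≤_; _<_; _+_; _*_; _^_; z≤n)
  open import Data.List.Membership.Propositional using (_∈_)
  open import Data.List.Membership.Propositional.Properties using (∈-map⁻; ∈-upTo⁻)
  open import Data.Product using (_×_)

  ∈-fromTo⁻ : ∀ {a b l} → l ∈ fromTo a b → a ≤ l × l ≤ b
  ∈-fromTo⁻ {a} {b} l∈ with ∈-map⁻ (_+_ a) l∈
  ... | r , r∈ , refl = ℕP.m≤m+n a r , ℕP.≤-pred (subst (_≤ suc b) (cong suc (ℕP.+-comm r a)) (ℕP.m≤o∸n⇒m+n≤o (suc r) a≤1+b r<))
    where
    r< : r < suc b ∸ a
    r< = ∈-upTo⁻ r∈
    a≤1+b : a ≤ suc b
    a≤1+b = ℕP.<⇒≤ (ℕP.m∸n≢0⇒n<m (λ eq → ℕP.n≮0 (subst (r <_) eq r<)))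

  colours<p : ∀ {m Δ p} → Δ ≤ m → 1 < p → m ^ 2 * (2 * Δ + 2) ≤ p → suc Δ < p
  colours<p {zero}  z≤n  1<p _     = 1<p
  colours<p {suc m} {Δ} _ _ bound =
    ℕP.<-≤-trans (ℕP.<-≤-trans (ℕP.n<1+n (suc Δ)) 2+Δ≤2Δ+2) (ℕP.≤-trans (ℕP.m≤n*m (2 * Δ + 2) (suc m ^ 2)) bound)
    where
    2+Δ≤2Δ+2 : 2 + Δ ≤ 2 * Δ + 2
    2+Δ≤2Δ+2 = subst (2 + Δ ≤_) (ℕP.+-comm 2 (2 * Δ)) (ℕP.+-monoʳ-≤ 2 (ℕP.m≤n*m Δ 2))

module AtColouring {n m : ℕ} (E : Edges n m) {q : ℕ} (pr : Prime (suc (suc q)))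
                   (colours<p : suc (maxDegree E) ℕ.< suc (suc q)) where

  open import Data.Integer.Divisibility using () renaming (_∣_ to _∣ᵤ_)
  open import Data.Integer.Divisibility.Signed using (_∣?_; ∣ᵤ⇒∣; ∣⇒∣ᵤ)
  open import Data.Nat using (_≤_; _<_; _+_; _%_)
  open import Data.Nat.DivMod using (m%n<n; m<n⇒m%n≡m; n%n≡0)
  open import Data.Fin as Fin using (Fin; toℕ)
  open import Data.Vec using (Vec)
  open import Data.List using (map; allFin)
  open import Data.List.Membership.Propositional using (_∈_)
  open import Data.List.Membership.Propositional.Properties using (∈-filter⁻)
  open import Data.Product using (Σ; ∃; _,_; proj₁; proj₂)
  open import Data.Sum using (inj₁; inj₂)
  open import Relation.Nullary using (¬_; Dec)
  import Relation.Nullary.Decidable as Dec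
  open Evaluation
  open Colouring using (colouring)
  open Nonvanishing
  open Bounds using (∈-fromTo⁻)

  private
    p : ℕ
    p = suc (suc q)

    Δ : ℕ
    Δ = maxDegree E

  colour : Fin n → ℕ
  colour = proj₁ (colouring E)

  open Reduction pr colour (λ (_ : Fin m) → 0)
  open Congruence p
  open CommutativeRing ℤmod using () renaming (trans to ≈-trans)

  1≤colour : ∀ i → 1 ≤ colour i
  1≤colour i = proj₁ (proj₁ (proj₂ (colouring E)) i)

  colour<p : ∀ i → colour i < p
  colour<p i = ℕP.≤-<-trans (proj₂ (proj₁ (proj₂ (colouring E)) i)) colours<p

  prime∤eval-difference : ∀ i Q b → eval x y Q ≡ + b → b ≢ colour i → b < p → ¬ + p ∣ᵤ eval x y (var-v i ⊖ Q)
  prime∤eval-difference i Q b evalQ b≢colour b<p =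
    subst (λ z → ¬ + p ∣ᵤ z) (sym (trans (eval-⊖ x y (var-v i) Q) (cong₂ _-_ (eval-var-v x y i) evalQ)))
          (distinct-residues (b≢colour ∘ sym) (colour<p i) b<p)

  residue≢colour : ∀ i {l} → l ∈ fromTo (Δ + 2) p → l % p ≢ colour i
  residue≢colour i {l} l∈ with ∈-fromTo⁻ l∈
  ... | Δ+2≤l , l≤p with ℕP.m≤n⇒m<n∨m≡n l≤p
  ...   | inj₁ l<p = λ eq → ℕP.<⇒≢ colour<l (trans (sym eq) (m<n⇒m%n≡m l<p))
    where
    colour<l : colour i < l
    colour<l = ℕP.≤-trans (ℕ.s≤s (proj₂ (proj₁ (proj₂ (colouring E)) i))) (subst (_≤ l) (ℕP.+-comm Δ 2) Δ+2≤l)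
  ...   | inj₂ refl = λ eq → ℕP.<⇒≢ (1≤colour i) (trans (sym (n%n≡0 p)) eq)

  prime∤eval-factorAt : ∀ i → ¬ + p ∣ᵤ eval x y (factorAt p E i)
  prime∤eval-factorAt i =
    prime∤eval-⊗ pr x y (prodP (map neighbourFactor (laterNbrs E i)))
                        (prodP (map edgeFactor (incEdges E i)) ⊗ prodP (map constantFactor (fromTo (Δ + 2) p)))
      (prime∤eval-prodP-map pr x y neighbourFactor (laterNbrs E i) neighbour)
      (prime∤eval-⊗ pr x y (prodP (map edgeFactor (incEdges E i))) (prodP (map constantFactor (fromTo (Δ + 2) p)))
        (prime∤eval-prodP-map pr x y edgeFactor (incEdges E i) edge)
        (prime∤eval-prodP-map pr x y constantFactor (fromTo (Δ + 2) p) constant))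
    where
    neighbourFactor : Fin n → Poly n m
    neighbourFactor j = var-v i ⊖ var-v j
    edgeFactor : Fin m → Poly n m
    edgeFactor j = var-v i ⊖ var-e j
    -- Defs writes the modulus as suc (p ∸ 1), which is p here.
    constantFactor : ℕ → Poly n m
    constantFactor l = var-v i ⊖ const (+ (l % p))
    neighbour : ∀ j → j ∈ laterNbrs E i → ¬ + p ∣ᵤ eval x y (var-v i ⊖ var-v j)
    neighbour j j∈ with ∈-filter⁻ (λ j → i Fin.<? j) {xs = nbrs E i} j∈
    ... | j∈nbrs , i<j = prime∤eval-difference i (var-v j) (colour j) (eval-var-v x y j)
                           (proj₂ (proj₂ (colouring E)) i j i<j (proj₂ (∈-filter⁻ (adj? E i) {xs = allFin n} j∈nbrs)) ∘ sym)
                           (colour<p j)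
    edge : ∀ j → j ∈ incEdges E i → ¬ + p ∣ᵤ eval x y (var-v i ⊖ var-e j)
    edge j _ = prime∤eval-difference i (var-e j) 0 (eval-var-e x y j) (ℕP.<⇒≢ (1≤colour i)) ℕ.z<s
    constant : ∀ l → l ∈ fromTo (Δ + 2) p → ¬ + p ∣ᵤ eval x y (var-v i ⊖ const (+ (l % p)))
    constant l l∈ = prime∤eval-difference i (const (+ (l % p))) (l % p) (eval-const x y _) (residue≢colour i l∈) (m%n<n l p)

  prime∤eval-bigP : ¬ + p ∣ᵤ eval x y (bigP p E)
  prime∤eval-bigP = prime∤eval-prodP-map pr x y (factorAt p E) (allFin n) (λ i _ → prime∤eval-factorAt i)

  private
    zero? : ∀ z → Dec (z ≈ 0ℤ)
    zero? z = Dec.map′ congruent _≈_.divides-difference (+ p ∣? (z - 0ℤ))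

    weightedSum≉0 : ¬ weightedSum (bigP p E) ≈ 0ℤ
    weightedSum≉0 W≈0 = prime∤eval-bigP (∣⇒∣ᵤ (≈0⇒∣ (≈-trans (eval≈weightedSum (bigP p E)) W≈0)))

    coefficient : ∀ l k → ¬ classSum (l , k) (bigP p E) ≈ 0ℤ → ¬ + p ∣ᵤ coeffRed p (bigP p E) l k
    coefficient l k class≉0 p∣ = class≉0 (subst (_≈ 0ℤ) (coeffRed≡classSum (bigP p E) l k) (∣⇒≈0 (∣ᵤ⇒∣ p∣)))

  nonzero-coefficient : Σ (Vec ℕ n) λ l → Σ (Vec ℕ m) λ k → ¬ + p ∣ᵤ coeffRed p (bigP p E) l k
  nonzero-coefficient = fromClass (nonzero-classSum zero? (bigP p E) weightedSum≉0)
    where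
    fromClass : (∃ λ lk → ¬ classSum lk (bigP p E) ≈ 0ℤ) → Σ (Vec ℕ n) λ l → Σ (Vec ℕ m) λ k → ¬ + p ∣ᵤ coeffRed p (bigP p E) l k
    fromClass ((l , k) , class≉0) = l , k , coefficient l k class≉0

open import Data.Nat using (ℕ; _*_; _+_; _^_; _≤_)
open import Data.Nat.Primality using (Prime)
open import Data.Integer using (+_)
open import Data.Integer.Divisibility using (_∣_)
open import Data.Vec using (Vec)
open import Data.Product using (Σ; _×_)
open import Relation.Nullary using (¬_; contradiction)

theorem3 : (n m : ℕ) (E : Edges n m) → Simple E →
    (p : ℕ) → Prime p → m ^ 2 * (2 * maxDegree E + 2) ≤ p →
    Σ (Vec ℕ n) (λ l → Σ (Vec ℕ m) (λ k → ¬ ((+ p) ∣ coeffRed p (bigP p E) l k)))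
theorem3 n m E _ zero          pr _     = contradiction (Fermat.prime⇒>1 pr) λ ()
theorem3 n m E _ (suc zero)    pr _     = contradiction (Fermat.prime⇒>1 pr) (ℕP.<-irrefl refl)
theorem3 n m E _ (suc (suc q)) pr bound =
  AtColouring.nonzero-coefficient E pr (Bounds.colours<p (Colouring.maxDegree≤m E) (Fermat.prime⇒>1 pr) bound)
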